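{- In the setting below, the map $h$ satisfies, for all $a,b\in K$: $h(\top)=\Sigma^*$; $h(\mathbf 1)=\{\varepsilon\}^{\rhd\lhd}$; $h(a\cdot b)=(h(a)\cdot h(b))^{\rhd\lhd}$; $h(a\backslash b)=h(a)\backslash h(b)$; $h(b/a)=h(b)/h(a)$; $h(a\wedge b)=h(a)\cap h(b)$; $h(a\vee b)=(h(a)\cup h(b))^{\rhd\lhd}$; $h(a^*)=(h(a)^*)^{\rhd\lhd}$. Moreover, if $a\preceq b$ then $h(a)\subseteq h(b)$.
   Context: Let $\mathcal K=(K;\preceq,\cdot,\backslash,/,\wedge,\vee,\top,\bot,\mathbf 1,{}^*)$ be an infinitary action lattice: $(K;\preceq,\wedge,\vee,\top,\bot)$ a bounded lattice, $(K;\cdot,\mathbf 1)$ a monoid, $b\preceq a\backslash c\iff a\cdot b\preceq c\iff a\preceq c/b$, and $a^*=\sup\{a^n\mid n\ge0\}$ with $a^0=\mathbf 1$. Let $\overline\Sigma=\{\overline a\mid a\in K\}$, $\underline\Sigma=\{\underline b\mid b\in K\}$ be disjoint copies of $K$, $\Sigma=\overline\Sigma\cup\underline\Sigma$. For $w=\overline{a_1}\cdots\overline{a_n}\in\overline\Sigma^*$, $w^\bullet=a_1\cdot\ldots\cdot a_n$ (with $\varepsilon^\bullet=\mathbf 1$); $|x|_{\underline\Sigma}$ counts letters from $\underline\Sigma$. $L=\{w\underline b u\mid w,u\in\overline\Sigma^*,b\in K,w^\bullet\preceq b,u^\bullet\preceq\mathbf 1\}\cup\{x\in\Sigma^*\mid|x|_{\underline\Sigma}\ge2\}$,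 and $h(b)=\{x\in\Sigma^*\mid x\underline b\in L\}$. For $M\subseteq\Sigma^*$, $M^{\rhd}=\{(x,y)\in\Sigma^*\times\Sigma^*\mid\forall w\in M\;xwy\in L\}$; for $C\subseteq\Sigma^*\times\Sigma^*$, $C^{\lhd}=\{v\in\Sigma^*\mid\forall(x,y)\in C\;xvy\in L\}$. $M_1\cdot M_2$ is concatenation, $M^*$ is Kleene star, $M_1\backslash M_2=\{u\in\Sigma^*\mid\forall v\in M_1\;vu\in M_2\}$, $M_2/M_1=\{u\in\Sigma^*\mid\forall v\in M_1\;uv\in M_2\}$. -}

module Defs where

open import Level using (Level; _⊔_; Lift) renaming (suc to lsuc)
open import Data.Nat using (ℕ; zero; suc; _≤_)
open import Data.List using (List; []; _∷_; _++_; map; foldr; [_])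
open import Data.Sum using (_⊎_; inj₁; inj₂)
open import Data.Product using (Σ; ∃; _×_; _,_)
open import Data.Unit.Polymorphic using (⊤)
open import Relation.Binary.PropositionalEquality using (_≡_)
open import Relation.Binary.Lattice.Structures using (IsBoundedLattice)
open import Algebra.Structures using (IsMonoid)

power : ∀ {c} {A : Set c} → (A → A → A) → A → A → ℕ → A
power _·_ e a zero    = e
power _·_ e a (suc n) = a · power _·_ e a n

record InfActionLattice (c ℓ : Level) : Set (lsuc (c ⊔ ℓ)) where
  infixl 7 _·_
  field
    Carrier : Set c
    _≼_     : Carrier → Carrier → Set ℓ
    _·_ _\\_ _//_ _∧_ _∨_ : Carrier → Carrier → Carrier
    top bot 𝟏 : Carrier
    _⋆      : Carrier → Carrier
    isBoundedLattice : IsBoundedLattice _≡_ _≼_ _∨_ _∧_ top bot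
    isMonoid : IsMonoid _≡_ _·_ 𝟏
    resid-\\ : ∀ a b c → (b ≼ (a \\ c) → (a · b) ≼ c) × ((a · b) ≼ c → b ≼ (a \\ c))
    resid-// : ∀ a b c → (a ≼ (c // b) → (a · b) ≼ c) × ((a · b) ≼ c → a ≼ (c // b))

    star-upper : ∀ a n → (power _·_ 𝟏 a n) ≼ (a ⋆)
    star-least : ∀ a c → (∀ n → (power _·_ 𝟏 a n) ≼ c) → (a ⋆) ≼ c

module Construction {c ℓ : Level} (𝒦 : InfActionLattice c ℓ) where
  open InfActionLattice 𝒦

  -- Σ = overline-copy ⊎ underline-copy of K: inj₁ a = \overline a, inj₂ b = \underline b
  Letter : Set c
  Letter = Carrier ⊎ Carrier

  Word : Set c
  Word = List Letter

  over : List Carrier → Word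
  over = map inj₁

  -- w^• for w ∈ \overline Σ^* (given as the list of underlying elements)
  prod : List Carrier → Carrier
  prod = foldr _·_ 𝟏

  countUnder : Word → ℕ
  countUnder []             = 0
  countUnder (inj₁ _ ∷ x)   = countUnder x
  countUnder (inj₂ _ ∷ x)   = suc (countUnder x)

  Lang : Set (lsuc (c ⊔ ℓ))
  Lang = Word → Set (c ⊔ ℓ)

  Rel₂ : Set (lsuc (c ⊔ ℓ))
  Rel₂ = Word → Word → Set (c ⊔ ℓ)

  L : Lang
  L x = (Σ (List Carrier) λ w → Σ (List Carrier) λ u → Σ Carrier λ b →
          (x ≡ over w ++ inj₂ b ∷ over u) × (prod w ≼ b) × (prod u ≼ 𝟏))
        ⊎ Lift (c ⊔ ℓ) (2 ≤ countUnder x)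

  h : Carrier → Lang
  h b x = L (x ++ [ inj₂ b ])

  _▷ : Lang → Rel₂
  (M ▷) x y = ∀ w → M w → L (x ++ w ++ y)

  _◁ : Rel₂ → Lang
  (C ◁) v = ∀ x y → C x y → L (x ++ v ++ y)

  cl : Lang → Lang
  cl M = (M ▷) ◁

  _⊆_ : Lang → Lang → Set (c ⊔ ℓ)
  M ⊆ N = ∀ x → M x → N x

  _≐_ : Lang → Lang → Set (c ⊔ ℓ)
  M ≐ N = (M ⊆ N) × (N ⊆ M)

  full : Lang
  full _ = ⊤

  ｛ε｝ : Lang
  ｛ε｝ x = Lift (c ⊔ ℓ) (x ≡ [])

  _∙_ : Lang → Lang → Lang
  (M₁ ∙ M₂) x = Σ Word λ u → Σ Word λ v → (x ≡ u ++ v) × M₁ u × M₂ v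

  pow : Lang → ℕ → Lang
  pow M zero    = ｛ε｝
  pow M (suc n) = M ∙ pow M n

  star : Lang → Lang
  star M x = ∃ λ n → pow M n x

  _⟍_ : Lang → Lang → Lang
  (M₁ ⟍ M₂) u = ∀ v → M₁ v → M₂ (v ++ u)

  _⟋_ : Lang → Lang → Lang
  (M₂ ⟋ M₁) u = ∀ v → M₁ v → M₂ (u ++ v)

  _∩_ : Lang → Lang → Lang
  (M ∩ N) x = M x × N x

  _∪_ : Lang → Lang → Lang
  (M ∪ N) x = M x ⊎ N x

  Lemma7Conclusion : Set (c ⊔ ℓ)
  Lemma7Conclusion =
      (h top ≐ full)
    × (h 𝟏 ≐ cl ｛ε｝)
    × (∀ a b → h (a · b) ≐ cl (h a ∙ h b))
    × (∀ a b → h (a \\ b) ≐ (h a ⟍ h b))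
    × (∀ a b → h (b // a) ≐ (h b ⟋ h a))
    × (∀ a b → h (a ∧ b) ≐ (h a ∩ h b))
    × (∀ a b → h (a ∨ b) ≐ cl (h a ∪ h b))
    × (∀ a → h (a ⋆) ≐ cl (star (h a)))
    × (∀ a b → a ≼ b → h a ⊆ h b)

-- A word without underlined letters is in h b exactly when its product is below b, and every
-- word with an underlined letter is in h b (appending b̲ puts two underlined letters in it). So
-- h b is determined by the down-set of b, and each clause reduces to a fact about the lattice.
-- The closures need one more observation: for an overline word v₀, the contexts (y , z) with
-- y v₀ z ∈ L are all of the form "plug in any overline v with v^• below t" for a single t,
-- obtained from the position of the underlined letter by residuation. So if M contains an
-- overline word, (M^▷)^◁ contains an overline word v exactly when v^• is below every upper
-- bound of the products of the overline words of M.
{-# OPTIONS --safe #-}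
module Submission where

open import Defs
open import Level using (Level; _⊔_; lift)
open import Data.Nat using (zero; suc; _≤_; _+_; s≤s; z≤n)
open import Data.Nat.Properties using (+-suc; +-mono-≤; +-monoˡ-≤; <⇒≤; ≤-reflexive)
open import Data.List using (List; []; _∷_; _++_; [_]; replicate)
open import Data.List.Properties using (map-++; ++-assoc; ∷-injective; map-injective)
open import Data.Sum using (_⊎_; inj₁; inj₂)
open import Data.Sum.Properties using (inj₁-injective; inj₂-injective)
open import Data.Product using (∃; ∃₂; _×_; _,_; proj₁; proj₂)
open import Data.Unit.Polymorphic using (tt)
open import Function.Bundles using (_⇔_; mk⇔; Equivalence)
open import Function.Related.Propositional using (module EquationalReasoning)
import Function.Properties.Equivalence as ⇔
open import Relation.Binary.PropositionalEquality using (_≡_; refl; sym; trans; cong; cong₂; subst; module ≡-Reasoning)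
open import Relation.Binary.Lattice.Structures using (IsBoundedLattice)
open import Algebra.Structures using (IsMonoid)

module Properties {c ℓ : Level} (𝒦 : InfActionLattice c ℓ) where
  open InfActionLattice 𝒦
  open Construction 𝒦
  open IsBoundedLattice isBoundedLattice
    using (maximum; supremum; infimum)
    renaming (refl to ≼-refl; reflexive to ≼-reflexive; trans to ≼-trans)
  open IsMonoid isMonoid using (assoc; identityˡ; identityʳ)
  open Equivalence using (to; from)

  \\-residual : ∀ {a b d} → (a · b) ≼ d ⇔ b ≼ (a \\ d)
  \\-residual {a} {b} {d} = mk⇔ (proj₂ (resid-\\ a b d)) (proj₁ (resid-\\ a b d))

  //-residual : ∀ {a b d} → (a · b) ≼ d ⇔ a ≼ (d // b)
  //-residual {a} {b} {d} = mk⇔ (proj₂ (resid-// a b d)) (proj₁ (resid-// a b d))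

  sandwich-residual : ∀ {p v s d} → (p · (v · s)) ≼ d ⇔ v ≼ ((p \\ d) // s)
  sandwich-residual = ⇔.trans \\-residual //-residual

  ·-monoˡ : ∀ {a a′ b} → a ≼ a′ → (a · b) ≼ (a′ · b)
  ·-monoˡ a≼a′ = from //-residual (≼-trans a≼a′ (to //-residual ≼-refl))

  ·-monoʳ : ∀ {a b b′} → b ≼ b′ → (a · b) ≼ (a · b′)
  ·-monoʳ b≼b′ = from \\-residual (≼-trans b≼b′ (to \\-residual ≼-refl))

  ·-mono : ∀ {a a′ b b′} → a ≼ a′ → b ≼ b′ → (a · b) ≼ (a′ · b′)
  ·-mono a≼a′ b≼b′ = ≼-trans (·-monoˡ a≼a′) (·-monoʳ b≼b′)

  prod-++ : ∀ p q → prod (p ++ q) ≡ prod p · prod q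
  prod-++ []      q = sym (identityˡ (prod q))
  prod-++ (a ∷ p) q = trans (cong (a ·_) (prod-++ p q)) (sym (assoc a (prod p) (prod q)))

  prod-++-++ : ∀ p v s → prod (p ++ v ++ s) ≡ prod p · (prod v · prod s)
  prod-++-++ p v s = trans (prod-++ p (v ++ s)) (cong (prod p ·_) (prod-++ v s))

  prod-replicate : ∀ n a → prod (replicate n a) ≡ power _·_ 𝟏 a n
  prod-replicate zero    a = refl
  prod-replicate (suc n) a = cong (a ·_) (prod-replicate n a)

  infix 6 _⟪_⟫_
  _⟪_⟫_ : List Carrier → Carrier → List Carrier → Word
  w ⟪ b ⟫ u = over w ++ inj₂ b ∷ over u

  over-++ : ∀ p q → over (p ++ q) ≡ over p ++ over q
  over-++ = map-++ inj₁

  over-++-⟪⟫ : ∀ v w b u → over v ++ w ⟪ b ⟫ u ≡ (v ++ w) ⟪ b ⟫ u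
  over-++-⟪⟫ v w b u = trans (sym (++-assoc (over v) (over w) _)) (cong (_++ _) (sym (over-++ v w)))

  over-++⁻ : ∀ xs {ys q} → xs ++ ys ≡ over q →
             ∃₂ λ p r → xs ≡ over p × ys ≡ over r × q ≡ p ++ r
  over-++⁻ []           {q = q} eq = [] , q , refl , eq , refl
  over-++⁻ (inj₁ a ∷ xs) {q = a′ ∷ q} eq with ∷-injective eq
  ... | refl , eq′ with over-++⁻ xs eq′
  ...   | p , r , refl , refl , refl = a ∷ p , r , refl , refl , refl

  over-++-⟪⟫⁻ : ∀ v {z w b u} → over v ++ z ≡ w ⟪ b ⟫ u → ∃ λ w₂ → z ≡ w₂ ⟪ b ⟫ u
  over-++-⟪⟫⁻ []      {w = w} eq = w , eq
  over-++-⟪⟫⁻ (a ∷ v) {w = a′ ∷ w} eq = over-++-⟪⟫⁻ v (proj₂ (∷-injective eq))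

  ⟪⟫-injective : ∀ w {b u w′ b′ u′} → w ⟪ b ⟫ u ≡ w′ ⟪ b′ ⟫ u′ → w ≡ w′ × b ≡ b′ × u ≡ u′
  ⟪⟫-injective []      {w′ = []} eq with ∷-injective eq
  ... | b≡b′ , u≡u′ = refl , inj₂-injective b≡b′ , map-injective inj₁-injective u≡u′
  ⟪⟫-injective (a ∷ w) {w′ = a′ ∷ w′} eq with ∷-injective eq
  ... | a≡a′ , eq′ with ⟪⟫-injective w eq′
  ...   | w≡w′ , b≡b′ , u≡u′ = cong₂ _∷_ (inj₁-injective a≡a′) w≡w′ , b≡b′ , u≡u′

  ⟪⟫-infix-split : ∀ y {v₀ z w b u} → y ++ over v₀ ++ z ≡ w ⟪ b ⟫ u →
      (∃₂ λ w₁ w₂ → ∀ v → y ++ over v ++ z ≡ (w₁ ++ v ++ w₂) ⟪ b ⟫ u)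
    ⊎ (∃₂ λ u₁ u₂ → ∀ v → y ++ over v ++ z ≡ w ⟪ b ⟫ (u₁ ++ v ++ u₂))
  ⟪⟫-infix-split [] {v₀} {b = b} {u} eq with over-++-⟪⟫⁻ v₀ eq
  ... | w₂ , refl = inj₁ ([] , w₂ , λ v → over-++-⟪⟫ v w₂ b u)
  ⟪⟫-infix-split (inj₂ b ∷ y) {v₀} {w = []} eq with ∷-injective eq
  ... | refl , eq′ with over-++⁻ y eq′
  ...   | u₁ , _ , refl , eq″ , refl with over-++⁻ (over v₀) eq″
  ...     | _ , u₂ , _ , refl , _ =
    inj₂ (u₁ , u₂ , λ v → cong (inj₂ b ∷_)
      (sym (trans (over-++ u₁ (v ++ u₂)) (cong (over u₁ ++_) (over-++ v u₂)))))
  ⟪⟫-infix-split (inj₁ a ∷ y) {w = a′ ∷ w} eq with ∷-injective eq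
  ... | refl , eq′ with ⟪⟫-infix-split y eq′
  ...   | inj₁ (w₁ , w₂ , plug) = inj₁ (a ∷ w₁ , w₂ , λ v → cong (inj₁ a ∷_) (plug v))
  ...   | inj₂ (u₁ , u₂ , plug) = inj₂ (u₁ , u₂ , λ v → cong (inj₁ a ∷_) (plug v))

  countUnder-++ : ∀ x z → countUnder (x ++ z) ≡ countUnder x + countUnder z
  countUnder-++ []           z = refl
  countUnder-++ (inj₁ _ ∷ x) z = countUnder-++ x z
  countUnder-++ (inj₂ _ ∷ x) z = cong suc (countUnder-++ x z)

  countUnder-infix : ∀ y x z → countUnder (y ++ x ++ z) ≡ countUnder x + countUnder (y ++ z)
  countUnder-infix []           x z = countUnder-++ x z
  countUnder-infix (inj₁ _ ∷ y) x z = countUnder-infix y x z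
  countUnder-infix (inj₂ _ ∷ y) x z =
    trans (cong suc (countUnder-infix y x z)) (sym (+-suc (countUnder x) _))

  countUnder-over : ∀ q → countUnder (over q) ≡ 0
  countUnder-over []      = refl
  countUnder-over (_ ∷ q) = countUnder-over q

  countUnder-over-infix : ∀ y v z → countUnder (y ++ over v ++ z) ≡ countUnder (y ++ z)
  countUnder-over-infix y v z = trans (countUnder-infix y (over v) z) (cong (_+ _) (countUnder-over v))

  countUnder-⟪⟫ : ∀ w b u → countUnder (w ⟪ b ⟫ u) ≡ 1
  countUnder-⟪⟫ w b u = begin
    countUnder (over w ++ inj₂ b ∷ over u)
      ≡⟨ countUnder-++ (over w) _ ⟩
    countUnder (over w) + suc (countUnder (over u))
      ≡⟨ cong₂ (λ m n → m + suc n) (countUnder-over w) (countUnder-over u) ⟩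
    1 ∎
    where open ≡-Reasoning

  over-or-under : ∀ x → (∃ λ q → x ≡ over q) ⊎ 1 ≤ countUnder x
  over-or-under []           = inj₁ ([] , refl)
  over-or-under (inj₂ _ ∷ x) = inj₂ (s≤s z≤n)
  over-or-under (inj₁ a ∷ x) with over-or-under x
  ... | inj₁ (q , refl) = inj₁ (a ∷ q , refl)
  ... | inj₂ 1≤x        = inj₂ 1≤x

  L-⟪⟫⁺ : ∀ {w b u} → prod w ≼ b → prod u ≼ 𝟏 → L (w ⟪ b ⟫ u)
  L-⟪⟫⁺ {w} {b} {u} w≼b u≼𝟏 = inj₁ (w , u , b , refl , w≼b , u≼𝟏)

  L-⟪⟫⁻ : ∀ {w b u} → L (w ⟪ b ⟫ u) → prod w ≼ b × prod u ≼ 𝟏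
  L-⟪⟫⁻ {w} (inj₁ (_ , _ , _ , eq , w≼b , u≼𝟏)) with ⟪⟫-injective w eq
  ... | refl , refl , refl = w≼b , u≼𝟏
  L-⟪⟫⁻ {w} {b} {u} (inj₂ (lift 2≤)) with subst (2 ≤_) (countUnder-⟪⟫ w b u) 2≤
  ... | s≤s ()

  L-⟪⟫-left : ∀ {w b u} → prod u ≼ 𝟏 → L (w ⟪ b ⟫ u) ⇔ prod w ≼ b
  L-⟪⟫-left u≼𝟏 = mk⇔ (λ H → proj₁ (L-⟪⟫⁻ H)) (λ w≼b → L-⟪⟫⁺ w≼b u≼𝟏)

  L-⟪⟫-right : ∀ {w b u} → prod w ≼ b → L (w ⟪ b ⟫ u) ⇔ prod u ≼ 𝟏
  L-⟪⟫-right w≼b = mk⇔ (λ H → proj₂ (L-⟪⟫⁻ H)) (L-⟪⟫⁺ w≼b)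

  L-underlined : ∀ {x} → L x → 1 ≤ countUnder x
  L-underlined (inj₁ (w , u , b , refl , _)) = ≤-reflexive (sym (countUnder-⟪⟫ w b u))
  L-underlined (inj₂ (lift 2≤))              = <⇒≤ 2≤

  L-infix-underlined : ∀ y v x z → 1 ≤ countUnder x → L (y ++ over v ++ z) → L (y ++ x ++ z)
  L-infix-underlined y v x z 1≤x H = inj₂ (lift (subst (2 ≤_) (sym (countUnder-infix y x z))
    (+-mono-≤ 1≤x (subst (1 ≤_) (countUnder-over-infix y v z) (L-underlined H)))))

  ContextBound : Word → Word → Carrier → Set (c ⊔ ℓ)
  ContextBound y z t = ∀ v → L (y ++ over v ++ z) ⇔ prod v ≼ t

  context-bound : ∀ y z {v₀} → L (y ++ over v₀ ++ z) → ∃ (ContextBound y z)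
  context-bound y z {v₀} (inj₂ (lift 2≤)) = top , λ v → mk⇔ (λ _ → maximum (prod v))
    (λ _ → inj₂ (lift (subst (2 ≤_)
      (trans (countUnder-over-infix y v₀ z) (sym (countUnder-over-infix y v z))) 2≤)))
  context-bound y z (inj₁ (w , u , b , eq , w≼b , u≼𝟏)) with ⟪⟫-infix-split y eq
  ... | inj₁ (w₁ , w₂ , plug) = (prod w₁ \\ b) // prod w₂ , λ v → begin
    L (y ++ over v ++ z)                   ≡⟨ cong L (plug v) ⟩
    L ((w₁ ++ v ++ w₂) ⟪ b ⟫ u)            ∼⟨ L-⟪⟫-left u≼𝟏 ⟩
    prod (w₁ ++ v ++ w₂) ≼ b               ≡⟨ cong (_≼ b) (prod-++-++ w₁ v w₂) ⟩
    (prod w₁ · (prod v · prod w₂)) ≼ b     ∼⟨ sandwich-residual ⟩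
    prod v ≼ ((prod w₁ \\ b) // prod w₂)   ∎
    where open EquationalReasoning
  ... | inj₂ (u₁ , u₂ , plug) = (prod u₁ \\ 𝟏) // prod u₂ , λ v → begin
    L (y ++ over v ++ z)                   ≡⟨ cong L (plug v) ⟩
    L (w ⟪ b ⟫ (u₁ ++ v ++ u₂))            ∼⟨ L-⟪⟫-right w≼b ⟩
    prod (u₁ ++ v ++ u₂) ≼ 𝟏               ≡⟨ cong (_≼ 𝟏) (prod-++-++ u₁ v u₂) ⟩
    (prod u₁ · (prod v · prod u₂)) ≼ 𝟏     ∼⟨ sandwich-residual ⟩
    prod v ≼ ((prod u₁ \\ 𝟏) // prod u₂)   ∎
    where open EquationalReasoning

  h-over⁺ : ∀ q {b} → prod q ≼ b → h b (over q)
  h-over⁺ q q≼b = L-⟪⟫⁺ {w = q} q≼b ≼-refl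

  h-over⁻ : ∀ q {b} → h b (over q) → prod q ≼ b
  h-over⁻ _ H = proj₁ (L-⟪⟫⁻ H)

  h-under : ∀ {x b} → 1 ≤ countUnder x → h b x
  h-under {x} {b} 1≤x = inj₂ (lift (subst (2 ≤_) (sym (countUnder-++ x [ inj₂ b ])) (+-monoˡ-≤ 1 1≤x)))

  h-letter : ∀ a → h a [ inj₁ a ]
  h-letter a = h-over⁺ [ a ] (≼-reflexive (identityʳ a))

  OverBound : Lang → Carrier → Set (c ⊔ ℓ)
  OverBound M t = ∀ q → M (over q) → prod q ≼ t

  letter-bound : ∀ M {t} a → OverBound M t → M [ inj₁ a ] → a ≼ t
  letter-bound _ a bound Ma = subst (_≼ _) (identityʳ a) (bound [ a ] Ma)

  over-bound⇒⊆h : ∀ {M b} → OverBound M b → M ⊆ h b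
  over-bound⇒⊆h bound x Mx with over-or-under x
  ... | inj₁ (q , refl) = h-over⁺ q (bound q Mx)
  ... | inj₂ 1≤x        = h-under 1≤x

  h-mono : ∀ a b → a ≼ b → h a ⊆ h b
  h-mono a b a≼b = over-bound⇒⊆h (λ q H → ≼-trans (h-over⁻ q H) a≼b)

  h-∙ : ∀ {a c b} → (a · c) ≼ b → (h a ∙ h c) ⊆ h b
  h-∙ {a} {c} {b} ac≼b = over-bound⇒⊆h bound
    where
    bound : OverBound (h a ∙ h c) b
    bound q (u , v , eq , hu , hv) with over-++⁻ u (sym eq)
    ... | p , r , refl , refl , refl =
      ≼-trans (≼-reflexive (prod-++ p r)) (≼-trans (·-mono (h-over⁻ p hu) (h-over⁻ r hv)) ac≼b)

  cl⊆h : ∀ {M b} → M ⊆ h b → cl M ⊆ h b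
  cl⊆h {b = b} M⊆hb x H = H [] [ inj₂ b ] M⊆hb

  h⊆cl : ∀ {M b v₀} → M (over v₀) → (∀ t → OverBound M t → b ≼ t) → h b ⊆ cl M
  h⊆cl Mv₀ least x hx y z yMz with over-or-under x
  ... | inj₁ (q , refl) =
    let t , bound = context-bound y z (yMz _ Mv₀)
    in from (bound q) (≼-trans (h-over⁻ q hx) (least t λ m Mm → to (bound m) (yMz _ Mm)))
  ... | inj₂ 1≤x = L-infix-underlined y _ x z 1≤x (yMz _ Mv₀)

  h-top : h top ≐ full
  h-top = (λ _ _ → tt) , over-bound⇒⊆h (λ q _ → maximum (prod q))

  h-𝟏 : h 𝟏 ≐ cl ｛ε｝
  h-𝟏 = h⊆cl (lift refl) (λ t bound → bound [] (lift refl))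
      , cl⊆h (λ { _ (lift refl) → h-over⁺ [] ≼-refl })

  h-· : ∀ a b → h (a · b) ≐ cl (h a ∙ h b)
  h-· a b = h⊆cl ab (λ t bound → subst (_≼ t) (cong (a ·_) (identityʳ b)) (bound (a ∷ b ∷ []) ab))
          , cl⊆h (h-∙ ≼-refl)
    where
    ab : (h a ∙ h b) (over (a ∷ b ∷ []))
    ab = [ inj₁ a ] , [ inj₁ b ] , refl , h-letter a , h-letter b

  h-\\ : ∀ a b → h (a \\ b) ≐ (h a ⟍ h b)
  h-\\ a b = (λ x hx v hv → h-∙ (from \\-residual ≼-refl) (v ++ x) (v , x , refl , hv , hx))
           , over-bound⇒⊆h (λ q H → to \\-residual (h-over⁻ (a ∷ q) (H [ inj₁ a ] (h-letter a))))

  h-// : ∀ a b → h (b // a) ≐ (h b ⟋ h a)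
  h-// a b = (λ x hx v hv → h-∙ (from //-residual ≼-refl) (x ++ v) (x , v , refl , hx , hv))
           , over-bound⇒⊆h (λ q H → to //-residual (prod-∷ʳ-bound q (H [ inj₁ a ] (h-letter a))))
    where
    prod-∷ʳ-bound : ∀ q → h b (over q ++ [ inj₁ a ]) → (prod q · a) ≼ b
    prod-∷ʳ-bound q H = subst (_≼ b) (trans (prod-++ q [ a ]) (cong (prod q ·_) (identityʳ a)))
                          (h-over⁻ (q ++ [ a ]) (subst (h b) (sym (over-++ q [ a ])) H))

  h-∧ : ∀ a b → h (a ∧ b) ≐ (h a ∩ h b)
  h-∧ a b = (λ x H → h-mono _ a (proj₁ (infimum a b)) x H , h-mono _ b (proj₁ (proj₂ (infimum a b))) x H)
          , over-bound⇒⊆h (λ q (ha , hb) →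
              proj₂ (proj₂ (infimum a b)) (prod q) (h-over⁻ q ha) (h-over⁻ q hb))

  h-∨ : ∀ a b → h (a ∨ b) ≐ cl (h a ∪ h b)
  h-∨ a b = h⊆cl {M = h a ∪ h b} {v₀ = [ a ]} (inj₁ (h-letter a))
                 (λ t bound → proj₂ (proj₂ (supremum a b)) t
                   (letter-bound (h a ∪ h b) a bound (inj₁ (h-letter a)))
                   (letter-bound (h a ∪ h b) b bound (inj₂ (h-letter b))))
          , cl⊆h (λ { x (inj₁ H) → h-mono a _ (proj₁ (supremum a b)) x H
                    ; x (inj₂ H) → h-mono b _ (proj₁ (proj₂ (supremum a b))) x H })

  h-⋆ : ∀ a → h (a ⋆) ≐ cl (star (h a))
  h-⋆ a = h⊆cl (0 , lift refl)
               (λ t bound → star-least a t λ n →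
                 subst (_≼ t) (prod-replicate n a) (bound (replicate n a) (n , replicate∈pow n)))
        , cl⊆h (λ x (n , H) → h-mono _ (a ⋆) (star-upper a n) x (pow⊆h n x H))
    where
    replicate∈pow : ∀ n → pow (h a) n (over (replicate n a))
    replicate∈pow zero    = lift refl
    replicate∈pow (suc n) = [ inj₁ a ] , _ , refl , h-letter a , replicate∈pow n
    pow⊆h : ∀ n → pow (h a) n ⊆ h (power _·_ 𝟏 a n)
    pow⊆h zero    _ (lift refl)           = h-over⁺ [] ≼-refl
    pow⊆h (suc n) x (u , v , eq , hu , hv) = h-∙ ≼-refl x (u , v , eq , hu , pow⊆h n v hv)

lemma7 : {c ℓ : Level} (𝒦 : InfActionLattice c ℓ) → Construction.Lemma7Conclusion 𝒦
lemma7 𝒦 = h-top , h-𝟏 , h-· , h-\\ , h-// , h-∧ , h-∨ , h-⋆ , h-mono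
  where open Properties 𝒦
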